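{- Let $G$ be a finite non-trivial abelian group. If $|G|$ is even and $G$ is of type $(m_1,\ldots,m_{\operatorname{rk}(G)})$, then $$ s_{\min}(G)=\begin{cases}\operatorname{rk}(G) & \text{if } m_1=2,\\ \operatorname{rk}(G)+1 & \text{if } m_1>2.\end{cases}$$ If $|G|$ is odd, then $\operatorname{rk}(G)+1\le s_{\min}(G)\le 2\operatorname{rk}(G)+1$.
   Context: For a finite abelian group $G$ with $n=|G|$, let $\mathcal C(G)$ be the set of Hamiltonian cycles in the complete digraph on vertex set $G$; a cycle is written $C=(g_1,\ldots,g_n)$, a listing of all elements of $G$, indices modulo $n$. Let $S(C)=\{g_i+g_{i+1} : 1\le i\le n\}$ (indices mod $n$) be the set of sums of consecutive elements, and $s_{\min}(G)=\min\{|S(C)| : C\in\mathcal C(G)\}$. $\operatorname{rk}(G)$ is the rank of $G$ (minimum number of generators). "$G$ is of type $(m_1,\ldots,m_r)$" means $G\cong \mathbb Z/m_1\mathbb Z\oplus\cdots\oplus\mathbb Z/m_r\mathbb Z$ with $1<m_1\mid m_2\mid\cdots\mid m_r$ (invariant factor decomposition), $r=\operatorname{rk}(G)$. -}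

module Defs where

open import Data.Nat using (ℕ; zero; suc; _≤_; _<_; _%_)
open import Data.Nat.DivMod using (m%n<n)
open import Data.Fin as F using (Fin; toℕ; fromℕ<)
open import Data.Unit using (⊤; tt)
open import Data.Product using (_×_; _,_; Σ; ∃)
open import Data.Product.Properties using (≡-dec)
open import Data.List using (List; []; _∷_; _++_; [_]; zipWith; length; deduplicate)
open import Data.List.Membership.Propositional using (_∈_)
open import Data.List.Relation.Unary.Unique.Propositional using (Unique)
open import Relation.Binary.PropositionalEquality using (_≡_)
open import Relation.Binary.Definitions using (DecidableEquality)
import Data.Nat as N

El : List ℕ → Set
El []       = ⊤
El (m ∷ ms) = Fin m × El ms

_+ₘ_ : ∀ {m} → Fin m → Fin m → Fin m
_+ₘ_ {suc k} a b = fromℕ< (m%n<n (toℕ a N.+ toℕ b) (suc k))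

_⊕_ : ∀ {ms} → El ms → El ms → El ms
_⊕_ {[]}     _        _        = tt
_⊕_ {m ∷ ms} (a , x)  (b , y)  = (a +ₘ b) , (x ⊕ y)

_≟El_ : ∀ {ms} → DecidableEquality (El ms)
_≟El_ {[]}     tt tt = Relation.Nullary.yes Relation.Binary.PropositionalEquality.refl
  where import Relation.Nullary
_≟El_ {m ∷ ms} = ≡-dec F._≟_ _≟El_

-- A Hamiltonian cycle (g_1,...,g_n) of the complete digraph on G:
-- a listing of all elements of G, each exactly once (indices read mod n).
record HamCycle (ms : List ℕ) : Set where
  field
    list     : List (El ms)
    distinct : Unique list
    complete : ∀ g → g ∈ list

rotate : ∀ {A : Set} → List A → List A
rotate []       = []
rotate (x ∷ xs) = xs ++ [ x ]

sums : ∀ {ms} → List (El ms) → List (El ms)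
sums c = zipWith _⊕_ c (rotate c)

|S| : ∀ {ms} → HamCycle ms → ℕ
|S| C = length (deduplicate _≟El_ (sums (HamCycle.list C)))

IsSMin : List ℕ → ℕ → Set
IsSMin ms k = (Σ (HamCycle ms) λ C → |S| C ≡ k) × (∀ (C : HamCycle ms) → k ≤ |S| C)

-- Let r = rk G and list G = ℤ/m₁ ⊕ ⋯ ⊕ ℤ/m_r in mixed-radix counting order ψ0, ψ1, …, with
-- the first coordinate least significant.  Then ψ(i + 1) − ψi is one of the r carry vectors
-- (1,…,1,0,…,0), and the digitwise complement satisfies xᶜ + x = top = (m₁ − 1, …, m_r − 1).
--
-- If m₁ is even, the cycle ψ0, ψ0ᶜ, ψ2, ψ2ᶜ, ψ4, … has as consecutive sums
-- only top and the r elements top + e₁ + s, s a carry vector; for m₁ = 2 one of these is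
-- top + e₁ + e₁ = top.  If |G| is even, some m_i is even and is moved to the front.  If
-- |G| = 2t + 1, the cycle ψt, ψ(t+1)ᶜ, ψ(t+1), ψ(t+2)ᶜ, …, ψ(2t) has only the sums top,
-- top + ψt and top − s.
--
-- Let m = m₁ and let π : G → (ℤ/m)^r be the reduction, a surjective
-- homomorphism since m ∣ m_i.  If S(C) = {u₁, …, u_k} and x, y, w are consecutive in C, then
-- π w − π x = D (y + w) − D (x + y) with D u = π u − π u₁.  So every other element of C lies
-- in one coset of the span of the k − 1 elements D u_j (j ≥ 2), which has at most m^(k−1)
-- elements, and m^r ≤ 2 m^(k−1): k ≥ r if m = 2 and k ≥ r + 1 if m ≥ 3.

module Submission where

open import Defs
open import Level using (0ℓ)
open import Data.Nat
  using (ℕ; zero; suc; _+_; _*_; _∸_; _^_; _≤_; _<_; _%_; _/_; NonZero; z≤n; s≤s; s≤s⁻¹; z<s; _≤?_; _<?_; parity)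
open import Data.Nat.Properties
open import Data.Nat.DivMod
open import Data.Nat.Tactic.RingSolver using (solve-∀)
open import Data.Fin as Fin using (Fin; toℕ; fromℕ<; opposite)
open import Data.Fin.Properties using (toℕ-fromℕ<; toℕ-injective; toℕ<n; opposite-prop)
open import Data.Unit using (tt)
open import Data.Product using (_×_; _,_; Σ; ∃; ∃₂; proj₁; proj₂)
open import Data.List
  using (List; []; _∷_; map; _++_; [_]; length; applyUpTo; zipWith; deduplicate; filter; cartesianProductWith;
         replicate; drop)
open import Data.List.Properties
  using (length-map; length-++; length-applyUpTo; length-removeAt′; map-++; zipWith-map; map-zipWith; zipWith-cong)
open import Data.List.Membership.Propositional using (_∈_)
open import Data.List.Membership.Propositional.Properties
  using (∈-map⁺; ∈-map⁻; ∈-applyUpTo⁺; ∈-applyUpTo⁻; ∈-deduplicate⁻; ∈-deduplicate⁺; ∈-filter⁺;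
         ∈-filter⁻; ∈-cartesianProductWith⁺; ∈-cartesianProductWith⁻; ∈-++⁺ˡ; ∈-++⁺ʳ)
open import Data.List.Relation.Unary.Any as Any using (here; there)
open import Data.List.Relation.Unary.All as All using (All; []; _∷_)
open import Data.List.Relation.Unary.Unique.Propositional using (Unique; []; _∷_)
open import Data.List.Relation.Unary.Unique.Propositional.Properties using (applyUpTo⁺₁) renaming (map⁺ to Unique-map⁺)
open import Data.List.Relation.Unary.Unique.DecPropositional.Properties using (deduplicate-!)
open import Data.List.Relation.Binary.Subset.Propositional using (_⊆_)
open import Data.Nat.ListAction using (product)
open import Data.Nat.Divisibility using (_∣_; divides; n∣m*n; m∣m*n; ∣-refl; ∣-trans; ∣1⇒≡1; ∣⇒≤)
open import Data.Nat.Primality using (euclidsLemma; prime[2])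
open import Data.Sum as Sum using (_⊎_; inj₁; inj₂)
open import Data.List.Relation.Unary.Linked as Linked using (Linked; []; [-]; _∷_)
open import Data.List.Relation.Unary.Linked.Properties using (Linked⇒All)
open import Data.Parity.Base using (0ℙ; 1ℙ; _⁻¹)
open import Data.Parity.Properties using (⁻¹-selfInverse; suc-homo-⁻¹)
open import Algebra.Bundles using (AbelianGroup)
import Algebra.Properties.AbelianGroup as AbelianGroupProperties
import Algebra.Properties.CommutativeSemigroup as CommutativeSemigroupProperties
open import Relation.Binary.PropositionalEquality hiding ([_])
open import Function using (_∘_; id)
open import Relation.Nullary using (yes; no; ¬_; contradiction; _×-dec_)
open import Relation.Unary using (Decidable)
import Data.List.Relation.Unary.Unique.DecPropositional as UniqueDec
import Data.List.Membership.DecPropositional as MembershipDec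
open import Data.List.Extrema ≤-totalOrder using (argmin; argmin-all; f[argmin]≤f[xs])

open ≡-Reasoning

-- Arithmetic in ℤ/m

[m%d+n]%d≡[m+n]%d : ∀ m n d .{{_ : NonZero d}} → (m % d + n) % d ≡ (m + n) % d
[m%d+n]%d≡[m+n]%d m n d = begin
  (m % d + n) % d           ≡⟨ %-distribˡ-+ (m % d) n d ⟩
  (m % d % d + n % d) % d   ≡⟨ cong (λ x → (x + n % d) % d) (m%n%n≡m%n m d) ⟩
  (m % d + n % d) % d       ≡⟨ %-distribˡ-+ m n d ⟨
  (m + n) % d               ∎

[m+n%d]%d≡[m+n]%d : ∀ m n d .{{_ : NonZero d}} → (m + n % d) % d ≡ (m + n) % d
[m+n%d]%d≡[m+n]%d m n d = begin
  (m + n % d) % d   ≡⟨ cong (_% d) (+-comm m (n % d)) ⟩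
  (n % d + m) % d   ≡⟨ [m%d+n]%d≡[m+n]%d n m d ⟩
  (n + m) % d       ≡⟨ cong (_% d) (+-comm n m) ⟩
  (m + n) % d       ∎

module _ {k : ℕ} where

  toℕ-+ₘ : (a b : Fin (suc k)) → toℕ (a +ₘ b) ≡ (toℕ a + toℕ b) % suc k
  toℕ-+ₘ a b = toℕ-fromℕ< _

  +ₘ-comm : (a b : Fin (suc k)) → a +ₘ b ≡ b +ₘ a
  +ₘ-comm a b = toℕ-injective (begin
    toℕ (a +ₘ b)             ≡⟨ toℕ-+ₘ a b ⟩
    (toℕ a + toℕ b) % suc k  ≡⟨ cong (_% suc k) (+-comm (toℕ a) (toℕ b)) ⟩
    (toℕ b + toℕ a) % suc k  ≡⟨ toℕ-+ₘ b a ⟨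
    toℕ (b +ₘ a)             ∎)

  +ₘ-assoc : (a b c : Fin (suc k)) → (a +ₘ b) +ₘ c ≡ a +ₘ (b +ₘ c)
  +ₘ-assoc a b c = toℕ-injective (begin
    toℕ ((a +ₘ b) +ₘ c)                  ≡⟨ toℕ-+ₘ (a +ₘ b) c ⟩
    (toℕ (a +ₘ b) + toℕ c) % m           ≡⟨ cong (λ x → (x + toℕ c) % m) (toℕ-+ₘ a b) ⟩
    ((toℕ a + toℕ b) % m + toℕ c) % m    ≡⟨ [m%d+n]%d≡[m+n]%d (toℕ a + toℕ b) (toℕ c) m ⟩
    (toℕ a + toℕ b + toℕ c) % m          ≡⟨ cong (_% m) (+-assoc (toℕ a) (toℕ b) (toℕ c)) ⟩
    (toℕ a + (toℕ b + toℕ c)) % m        ≡⟨ [m+n%d]%d≡[m+n]%d (toℕ a) (toℕ b + toℕ c) m ⟨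
    (toℕ a + (toℕ b + toℕ c) % m) % m    ≡⟨ cong (λ x → (toℕ a + x) % m) (toℕ-+ₘ b c) ⟨
    (toℕ a + toℕ (b +ₘ c)) % m           ≡⟨ toℕ-+ₘ a (b +ₘ c) ⟨
    toℕ (a +ₘ (b +ₘ c))                  ∎)
    where m = suc k

  +ₘ-identityʳ : (a : Fin (suc k)) → a +ₘ Fin.zero ≡ a
  +ₘ-identityʳ a = toℕ-injective (begin
    toℕ (a +ₘ Fin.zero)   ≡⟨ toℕ-+ₘ a Fin.zero ⟩
    (toℕ a + 0) % suc k   ≡⟨ cong (_% suc k) (+-identityʳ (toℕ a)) ⟩
    toℕ a % suc k         ≡⟨ m<n⇒m%n≡m (toℕ<n a) ⟩
    toℕ a                 ∎)

  -ₘ_ : Fin (suc k) → Fin (suc k)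
  -ₘ a = fromℕ< (m%n<n (suc k ∸ toℕ a) (suc k))

  +ₘ-inverseʳ : (a : Fin (suc k)) → a +ₘ (-ₘ a) ≡ Fin.zero
  +ₘ-inverseʳ a = toℕ-injective (begin
    toℕ (a +ₘ (-ₘ a))               ≡⟨ toℕ-+ₘ a (-ₘ a) ⟩
    (toℕ a + toℕ (-ₘ a)) % m        ≡⟨ cong (λ x → (toℕ a + x) % m) (toℕ-fromℕ< _) ⟩
    (toℕ a + (m ∸ toℕ a) % m) % m   ≡⟨ [m+n%d]%d≡[m+n]%d (toℕ a) (m ∸ toℕ a) m ⟩
    (toℕ a + (m ∸ toℕ a)) % m       ≡⟨ cong (_% m) (m+[n∸m]≡n (<⇒≤ (toℕ<n a))) ⟩
    m % m                           ≡⟨ n%n≡0 m ⟩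
    0                               ∎)
    where m = suc k

  opposite-+ₘ : (a : Fin (suc k)) → opposite a +ₘ a ≡ opposite Fin.zero
  opposite-+ₘ a = toℕ-injective (begin
    toℕ (opposite a +ₘ a)               ≡⟨ toℕ-+ₘ (opposite a) a ⟩
    (toℕ (opposite a) + toℕ a) % suc k  ≡⟨ cong (λ x → (x + toℕ a) % suc k) (opposite-prop a) ⟩
    (k ∸ toℕ a + toℕ a) % suc k         ≡⟨ cong (_% suc k) (m∸n+n≡m (s≤s⁻¹ (toℕ<n a))) ⟩
    k % suc k                           ≡⟨ m<n⇒m%n≡m (n<1+n k) ⟩
    k                                   ≡⟨ opposite-prop {suc k} Fin.zero ⟨
    toℕ (opposite {suc k} Fin.zero)     ∎)

1ₘ : ∀ {k} → Fin (suc k)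
1ₘ {k} = fromℕ< (m%n<n 1 (suc k))

toℕ-+ₘ1ₘ : ∀ {k} (a : Fin (suc k)) → toℕ (a +ₘ 1ₘ) ≡ suc (toℕ a) % suc k
toℕ-+ₘ1ₘ {k} a = begin
  toℕ (a +ₘ 1ₘ)                  ≡⟨ toℕ-+ₘ a 1ₘ ⟩
  (toℕ a + toℕ (1ₘ {k})) % suc k ≡⟨ cong (λ x → (toℕ a + x) % suc k) (toℕ-fromℕ< _) ⟩
  (toℕ a + 1 % suc k) % suc k    ≡⟨ [m+n%d]%d≡[m+n]%d (toℕ a) 1 (suc k) ⟩
  (toℕ a + 1) % suc k            ≡⟨ cong (_% suc k) (+-comm (toℕ a) 1) ⟩
  suc (toℕ a) % suc k            ∎

fromℕ<≡+ₘ1ₘ : ∀ {k} (a : Fin (suc k)) (lt : suc (toℕ a) < suc k) → fromℕ< lt ≡ a +ₘ 1ₘ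
fromℕ<≡+ₘ1ₘ a lt = toℕ-injective (trans (toℕ-fromℕ< lt) (sym (trans (toℕ-+ₘ1ₘ a) (m<n⇒m%n≡m lt))))

max+ₘ1ₘ≡0 : ∀ {k} (a : Fin (suc k)) → toℕ a ≡ k → a +ₘ 1ₘ ≡ Fin.zero
max+ₘ1ₘ≡0 {k} a a≡k =
  toℕ-injective (trans (toℕ-+ₘ1ₘ a) (trans (cong (λ d → suc d % suc k) a≡k) (n%n≡0 (suc k))))

toℕ≡max : ∀ {k} (a : Fin (suc k)) → ¬ suc (toℕ a) < suc k → toℕ a ≡ k
toℕ≡max a a+1≮m = ≤-antisym (s≤s⁻¹ (toℕ<n a)) (s≤s⁻¹ (≮⇒≥ a+1≮m))

-- A modulus is written suc p, so that the group El (map suc ps) has a zero.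
0# : ∀ ps → El (map suc ps)
0# []       = tt
0# (p ∷ ps) = Fin.zero , 0# ps

infix 30 -_
-_ : ∀ {ps} → El (map suc ps) → El (map suc ps)
-_ {[]}     tt      = tt
-_ {p ∷ ps} (a , x) = -ₘ a , - x

_⊖_ : ∀ {ps} → El (map suc ps) → El (map suc ps) → El (map suc ps)
x ⊖ y = x ⊕ - y

⊕-comm : ∀ {ps} (x y : El (map suc ps)) → x ⊕ y ≡ y ⊕ x
⊕-comm {[]}     tt      tt      = refl
⊕-comm {p ∷ ps} (a , x) (b , y) = cong₂ _,_ (+ₘ-comm a b) (⊕-comm x y)

⊕-assoc : ∀ {ps} (x y z : El (map suc ps)) → (x ⊕ y) ⊕ z ≡ x ⊕ (y ⊕ z)
⊕-assoc {[]}     tt      tt      tt      = refl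
⊕-assoc {p ∷ ps} (a , x) (b , y) (c , z) = cong₂ _,_ (+ₘ-assoc a b c) (⊕-assoc x y z)

⊕-identityʳ : ∀ ps (x : El (map suc ps)) → x ⊕ 0# ps ≡ x
⊕-identityʳ []       tt      = refl
⊕-identityʳ (p ∷ ps) (a , x) = cong₂ _,_ (+ₘ-identityʳ a) (⊕-identityʳ ps x)

⊕-inverseʳ : ∀ ps (x : El (map suc ps)) → x ⊖ x ≡ 0# ps
⊕-inverseʳ []       tt      = refl
⊕-inverseʳ (p ∷ ps) (a , x) = cong₂ _,_ (+ₘ-inverseʳ a) (⊕-inverseʳ ps x)

⊕-abelianGroup : List ℕ → AbelianGroup 0ℓ 0ℓ
⊕-abelianGroup ps = record
  { Carrier        = El (map suc ps)
  ; _≈_            = _≡_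
  ; _∙_            = _⊕_
  ; ε              = 0# ps
  ; _⁻¹            = -_
  ; isAbelianGroup = record
    { isGroup = record
      { isMonoid = record
        { isSemigroup = record
          { isMagma = record { isEquivalence = isEquivalence ; ∙-cong = cong₂ _⊕_ }
          ; assoc   = ⊕-assoc }
        ; identity = (λ x → trans (⊕-comm (0# ps) x) (⊕-identityʳ ps x)) , ⊕-identityʳ ps }
      ; inverse = (λ x → trans (⊕-comm (- x) x) (⊕-inverseʳ ps x)) , ⊕-inverseʳ ps
      ; ⁻¹-cong = cong -_ }
    ; comm    = ⊕-comm }
  }

module _ {ps : List ℕ} where
  private
    𝔾 = ⊕-abelianGroup ps
  open AbelianGroup 𝔾 using (assoc; identityˡ; identityʳ; inverseʳ; commutativeSemigroup)
  open AbelianGroupProperties 𝔾 using (x≈z//y; ⁻¹-∙-comm)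
  open CommutativeSemigroupProperties commutativeSemigroup using (interchange; x∙yz≈y∙xz)

  ⊕≡⇒≡⊖ : {x y z : El (map suc ps)} → x ⊕ y ≡ z → x ≡ z ⊖ y
  ⊕≡⇒≡⊖ = x≈z//y _ _ _

  x⊕[y⊖[x⊕z]]≡y⊖z : (x y z : El (map suc ps)) → x ⊕ (y ⊖ (x ⊕ z)) ≡ y ⊖ z
  x⊕[y⊖[x⊕z]]≡y⊖z x y z = begin
    x ⊕ (y ⊕ - (x ⊕ z))       ≡⟨ cong (λ w → x ⊕ (y ⊕ w)) (⁻¹-∙-comm x z) ⟨
    x ⊕ (y ⊕ (- x ⊕ - z))     ≡⟨ x∙yz≈y∙xz x y (- x ⊕ - z) ⟩
    y ⊕ (x ⊕ (- x ⊕ - z))     ≡⟨ cong (y ⊕_) (assoc x (- x) (- z)) ⟨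
    y ⊕ ((x ⊕ - x) ⊕ - z)     ≡⟨ cong (λ w → y ⊕ (w ⊕ - z)) (inverseʳ x) ⟩
    y ⊕ (0# ps ⊕ - z)         ≡⟨ cong (y ⊕_) (identityˡ (- z)) ⟩
    y ⊖ z                     ∎

  [x⊖z]⊖[y⊖z]≡x⊖y : (x y z : El (map suc ps)) → (x ⊖ z) ⊖ (y ⊖ z) ≡ x ⊖ y
  [x⊖z]⊖[y⊖z]≡x⊖y x y z = begin
    (x ⊕ - z) ⊕ - (y ⊕ - z)         ≡⟨ cong ((x ⊕ - z) ⊕_) (⁻¹-∙-comm y (- z)) ⟨
    (x ⊕ - z) ⊕ (- y ⊕ - - z)       ≡⟨ interchange x (- z) (- y) (- - z) ⟩
    (x ⊕ - y) ⊕ (- z ⊕ - - z)       ≡⟨ cong ((x ⊕ - y) ⊕_) (inverseʳ (- z)) ⟩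
    (x ⊕ - y) ⊕ 0# ps               ≡⟨ identityʳ (x ⊕ - y) ⟩
    x ⊖ y                           ∎

  [x⊕y]⊖x≡y : (x y : El (map suc ps)) → (x ⊕ y) ⊖ x ≡ y
  [x⊕y]⊖x≡y x y = begin
    (x ⊕ y) ⊕ - x     ≡⟨ cong (_⊕ - x) (⊕-comm x y) ⟩
    (y ⊕ x) ⊕ - x     ≡⟨ assoc y x (- x) ⟩
    y ⊕ (x ⊕ - x)     ≡⟨ cong (y ⊕_) (inverseʳ x) ⟩
    y ⊕ 0# ps         ≡⟨ identityʳ y ⟩
    y                 ∎

-- Mixed-radix counting

encode : ∀ {ms} → El ms → ℕ
encode {[]}     tt      = 0
encode {m ∷ ms} (a , x) = toℕ a + encode x * m

encode< : ∀ {ms} (x : El ms) → encode x < product ms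
encode< {[]}     tt      = s≤s z≤n
encode< {m ∷ ms} (a , x) = <-≤-trans (+-monoˡ-< (encode x * m) (toℕ<n a))
  (≤-trans (*-monoˡ-≤ m (encode< x)) (≤-reflexive (*-comm (product ms) m)))

product>0 : ∀ ps → 0 < product (map suc ps)
product>0 ps = ≤-<-trans z≤n (encode< (0# ps))

encode-injective : ∀ {ms} {x y : El ms} → encode x ≡ encode y → x ≡ y
encode-injective {[]}          {tt}    {tt}    _  = refl
encode-injective {suc k ∷ ms}  {a , x} {b , y} eq = cong₂ _,_
  (toℕ-injective (begin
    toℕ a                           ≡⟨ digit a x ⟨
    (toℕ a + encode x * m) % m      ≡⟨ cong (_% m) eq ⟩
    (toℕ b + encode y * m) % m      ≡⟨ digit b y ⟩
    toℕ b                           ∎))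
  (encode-injective (begin
    encode x                        ≡⟨ rest a x ⟨
    (toℕ a + encode x * m) / m      ≡⟨ cong (_/ m) eq ⟩
    (toℕ b + encode y * m) / m      ≡⟨ rest b y ⟩
    encode y                        ∎))
  where
  m = suc k
  digit : (c : Fin m) (z : El ms) → (toℕ c + encode z * m) % m ≡ toℕ c
  digit c z = trans ([m+kn]%n≡m%n (toℕ c) (encode z) m) (m<n⇒m%n≡m (toℕ<n c))
  rest : (c : Fin m) (z : El ms) → (toℕ c + encode z * m) / m ≡ encode z
  rest c z = begin
    (toℕ c + encode z * m) / m      ≡⟨ +-distrib-/-∣ʳ (toℕ c) (n∣m*n (encode z)) ⟩
    toℕ c / m + encode z * m / m    ≡⟨ cong₂ _+_ (m<n⇒m/n≡0 (toℕ<n c)) (m*n/n≡m (encode z) m) ⟩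
    encode z                        ∎

next : ∀ {ms} → El ms → El ms
next {[]}         tt      = tt
next {suc k ∷ ms} (a , x) with suc (toℕ a) <? suc k
... | yes a+1<m = fromℕ< a+1<m , x
... | no  _     = Fin.zero , next x

encode-next : ∀ {ms} (x : El ms) → suc (encode x) < product ms → encode (next x) ≡ suc (encode x)
encode-next {[]}         tt      (s≤s ())
encode-next {suc k ∷ ms} (a , x) lt with suc (toℕ a) <? suc k
... | yes a+1<m = cong (_+ encode x * suc k) (toℕ-fromℕ< a+1<m)
... | no  a+1≮m = begin
    encode (next x) * suc k       ≡⟨ cong (_* suc k) (encode-next x x+1<) ⟩
    suc (encode x) * suc k        ≡⟨⟩
    suc (k + encode x * suc k)    ≡⟨ cong (λ d → suc (d + encode x * suc k)) (toℕ≡max a a+1≮m) ⟨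
    suc (toℕ a + encode x * suc k) ∎
  where
  x+1< : suc (encode x) < product ms
  x+1< = *-cancelʳ-< (suc k) (suc (encode x)) (product ms)
    (subst₂ _<_ (cong (λ d → suc (d + encode x * suc k)) (toℕ≡max a a+1≮m)) (*-comm (suc k) (product ms)) lt)

decode : ∀ ps → ℕ → El (map suc ps)
decode ps zero    = 0# ps
decode ps (suc i) = next (decode ps i)

encode-0# : ∀ ps → encode (0# ps) ≡ 0
encode-0# []       = refl
encode-0# (p ∷ ps) = cong (_* suc p) (encode-0# ps)

encode-decode : ∀ ps {i} → i < product (map suc ps) → encode (decode ps i) ≡ i
encode-decode ps {zero}  _  = encode-0# ps
encode-decode ps {suc i} lt = begin
  encode (next (decode ps i))  ≡⟨ encode-next (decode ps i) (subst (λ j → suc j < _) (sym ih) lt) ⟩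
  suc (encode (decode ps i))   ≡⟨ cong suc ih ⟩
  suc i                        ∎
  where ih = encode-decode ps (<-trans (n<1+n i) lt)

decode-encode : ∀ ps (x : El (map suc ps)) → decode ps (encode x) ≡ x
decode-encode ps x = encode-injective (encode-decode ps (encode< x))

complement : ∀ {ms} → El ms → El ms
complement {[]}     tt      = tt
complement {m ∷ ms} (a , x) = opposite a , complement x

top : ∀ ps → El (map suc ps)
top ps = complement (0# ps)

complement-⊕ : ∀ ps (x : El (map suc ps)) → complement x ⊕ x ≡ top ps
complement-⊕ []       tt      = refl
complement-⊕ (p ∷ ps) (a , x) = cong₂ _,_ (opposite-+ₘ a) (complement-⊕ ps x)

encode-complement : ∀ {ms} (x : El ms) → suc (encode x + encode (complement x)) ≡ product ms
encode-complement {[]}         tt      = refl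
encode-complement {suc k ∷ ms} (a , x) = begin
  suc ((toℕ a + v * m) + (toℕ (opposite a) + v′ * m))
    ≡⟨ regroup (toℕ a) (toℕ (opposite a)) v v′ ⟩
  suc (toℕ a + toℕ (opposite a)) + (v + v′) * m
    ≡⟨ cong (λ d → suc (toℕ a + d) + (v + v′) * m) (opposite-prop a) ⟩
  suc (toℕ a + (k ∸ toℕ a)) + (v + v′) * m
    ≡⟨ cong (λ d → suc d + (v + v′) * m) (m+[n∸m]≡n (s≤s⁻¹ (toℕ<n a))) ⟩
  suc (v + v′) * m
    ≡⟨ cong (_* m) (encode-complement x) ⟩
  product ms * m
    ≡⟨ *-comm (product ms) m ⟩
  m * product ms
    ∎
  where
  m = suc k
  v = encode x
  v′ = encode (complement x)
  regroup : ∀ a a′ v v′ → suc ((a + v * m) + (a′ + v′ * m)) ≡ suc (a + a′) + (v + v′) * m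
  regroup = solve-∀

complement-decode : ∀ ps i j → suc (i + j) ≡ product (map suc ps) → complement (decode ps i) ≡ decode ps j
complement-decode ps i j 1+i+j≡n = begin
  complement (decode ps i)                       ≡⟨ decode-encode ps _ ⟨
  decode ps (encode (complement (decode ps i)))  ≡⟨ cong (decode ps) (+-cancelˡ-≡ i _ _ (suc-injective sums≡)) ⟩
  decode ps j                                    ∎
  where
  i<n : i < product (map suc ps)
  i<n = subst (i <_) 1+i+j≡n (s≤s (m≤m+n i j))
  sums≡ : suc (i + encode (complement (decode ps i))) ≡ suc (i + j)
  sums≡ = trans (subst (λ v → suc (v + encode (complement (decode ps i))) ≡ product (map suc ps))
                  (encode-decode ps i<n) (encode-complement (decode ps i)))
                (sym 1+i+j≡n)

encode-top : ∀ ps → suc (encode (top ps)) ≡ product (map suc ps)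
encode-top ps = subst (λ v → suc (v + encode (top ps)) ≡ product (map suc ps)) (encode-0# ps) (encode-complement (0# ps))

decode-top : ∀ ps {i} → suc i ≡ product (map suc ps) → decode ps i ≡ top ps
decode-top ps eq = trans (cong (decode ps) (suc-injective (trans eq (sym (encode-top ps))))) (decode-encode ps (top ps))

next-top : ∀ ps → next (top ps) ≡ 0# ps
next-top []       = refl
next-top (p ∷ ps) with suc (toℕ (opposite {suc p} Fin.zero)) <? suc p
... | yes lt = contradiction (cong suc (opposite-prop {suc p} Fin.zero)) (<⇒≢ lt)
... | no  _  = cong (Fin.zero ,_) (next-top ps)

decode-product : ∀ ps → decode ps (product (map suc ps)) ≡ 0# ps
decode-product ps = begin
  decode ps (product (map suc ps))      ≡⟨ cong (decode ps) (encode-top ps) ⟨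
  next (decode ps (encode (top ps)))    ≡⟨ cong next (decode-encode ps (top ps)) ⟩
  next (top ps)                         ≡⟨ next-top ps ⟩
  0# ps                                 ∎

increments : ∀ ps → List (El (map suc ps))
increments []       = []
increments (p ∷ ps) = (1ₘ , 0# ps) ∷ map (1ₘ ,_) (increments ps)

length-increments : ∀ ps → length (increments ps) ≡ length ps
length-increments []       = refl
length-increments (p ∷ ps) = cong suc (trans (length-map (1ₘ {p} ,_) (increments ps)) (length-increments ps))

next-increment : ∀ p ps (x : El (map suc (p ∷ ps))) → ∃ λ s → s ∈ increments (p ∷ ps) × next x ≡ x ⊕ s
next-increment p ps (a , x) with suc (toℕ a) <? suc p
... | yes a+1<m = (1ₘ , 0# ps) , here refl , cong₂ _,_ (fromℕ<≡+ₘ1ₘ a a+1<m) (sym (⊕-identityʳ ps x))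
... | no  a+1≮m = carry ps x
  where
  wraps : Fin.zero ≡ a +ₘ 1ₘ
  wraps = sym (max+ₘ1ₘ≡0 a (toℕ≡max a a+1≮m))
  carry : ∀ ps (x : El (map suc ps)) → ∃ λ s → s ∈ increments (p ∷ ps) × (Fin.zero , next x) ≡ (a , x) ⊕ s
  carry []       tt = (1ₘ , tt) , here refl , cong (_, tt) wraps
  carry (q ∷ qs) x with next-increment q qs x
  ... | s , s∈ , eq = (1ₘ , s) , there (∈-map⁺ (1ₘ ,_) s∈) , cong₂ _,_ wraps eq

-- Hamiltonian cycles and their sums

∈-─⁺ : ∀ {A : Set} {x z : A} {ys : List A} (x∈ys : x ∈ ys) → z ∈ ys → z ≢ x → z ∈ (ys Any.─ x∈ys)
∈-─⁺ (here refl) (here refl) z≢x = contradiction refl z≢x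
∈-─⁺ (here _)    (there z∈)  _   = z∈
∈-─⁺ (there _)   (here z≡y)  _   = here z≡y
∈-─⁺ (there x∈)  (there z∈)  z≢x = there (∈-─⁺ x∈ z∈ z≢x)

Unique-⊆⇒length≤ : ∀ {A : Set} {xs ys : List A} → Unique xs → xs ⊆ ys → length xs ≤ length ys
Unique-⊆⇒length≤ {xs = []}             []           _      = z≤n
Unique-⊆⇒length≤ {xs = x ∷ xs} {ys} (x∉xs ∷ !xs) xs⊆ys =
  subst (suc (length xs) ≤_) (sym (length-removeAt′ ys (Any.index x∈ys)))
    (s≤s (Unique-⊆⇒length≤ !xs (λ z∈xs → ∈-─⁺ x∈ys (xs⊆ys (there z∈xs)) (x≢ z∈xs))))
  where
  x∈ys = xs⊆ys (here refl)
  x≢ : ∀ {z} → z ∈ xs → z ≢ x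
  x≢ z∈xs z≡x = All.lookup x∉xs z∈xs (sym z≡x)

|S|≤length : ∀ {ms} (C : HamCycle ms) {L : List (El ms)} → sums (HamCycle.list C) ⊆ L → |S| C ≤ length L
|S|≤length C sums⊆L = Unique-⊆⇒length≤ (deduplicate-! _≟El_ _) (sums⊆L ∘ ∈-deduplicate⁻ _≟El_ _)

applyUpTo-hamCycle : ∀ ps (f : ℕ → El (map suc ps)) (σ : ℕ → ℕ) →
  (∀ {v} → v < product (map suc ps) → σ v < product (map suc ps)) →
  (∀ {v} → v < product (map suc ps) → f (σ v) ≡ decode ps v) →
  (∀ {i} → i < product (map suc ps) → σ (encode (f i)) ≡ i) → HamCycle (map suc ps)
applyUpTo-hamCycle ps f σ σ< f∘σ σ∘encode∘f = record
  { list     = applyUpTo f n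
  ; distinct = applyUpTo⁺₁ f n (λ i<j j<n fi≡fj → <⇒≢ i<j
      (trans (sym (σ∘encode∘f (<-trans i<j j<n))) (trans (cong (σ ∘ encode) fi≡fj) (σ∘encode∘f j<n))))
  ; complete = λ g → subst (_∈ applyUpTo f n) (trans (f∘σ (encode< g)) (decode-encode ps g))
                       (∈-applyUpTo⁺ f (σ< (encode< g)))
  }
  where n = product (map suc ps)

countingCycle : ∀ ps → HamCycle (map suc ps)
countingCycle ps = applyUpTo-hamCycle ps (decode ps) id id (λ _ → refl) (encode-decode ps)

sums-applyUpTo-⊆ : ∀ {ms} (f : ℕ → El ms) n {L : List (El ms)} →
  (∀ {i} → i < n → f i ⊕ f (suc i) ∈ L) → f n ⊕ f 0 ∈ L → sums (applyUpTo f (suc n)) ⊆ L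
sums-applyUpTo-⊆ f n {L} inner last = shifted f n inner last
  where
  shifted : ∀ (g : ℕ → El _) k → (∀ {i} → i < k → g i ⊕ g (suc i) ∈ L) → g k ⊕ f 0 ∈ L →
    zipWith _⊕_ (applyUpTo g (suc k)) (applyUpTo (g ∘ suc) k ++ [ f 0 ]) ⊆ L
  shifted g zero    _     lastg (here refl) = lastg
  shifted g (suc k) inner _     (here refl) = inner (s≤s z≤n)
  shifted g (suc k) inner lastg (there s∈)  = shifted (g ∘ suc) k (inner ∘ s≤s) lastg s∈

rotate-map : ∀ {A B : Set} (f : A → B) xs → rotate (map f xs) ≡ map f (rotate xs)
rotate-map f []       = refl
rotate-map f (x ∷ xs) = sym (map-++ f xs [ x ])

sums-map : ∀ {ms ms′} (φ : El ms → El ms′) → (∀ x y → φ (x ⊕ y) ≡ φ x ⊕ φ y) →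
  ∀ xs → sums (map φ xs) ≡ map φ (sums xs)
sums-map φ φ-hom xs = begin
  zipWith _⊕_ (map φ xs) (rotate (map φ xs))     ≡⟨ cong (zipWith _⊕_ (map φ xs)) (rotate-map φ xs) ⟩
  zipWith _⊕_ (map φ xs) (map φ (rotate xs))     ≡⟨ zipWith-map _⊕_ φ φ xs (rotate xs) ⟩
  zipWith (λ x y → φ x ⊕ φ y) xs (rotate xs)     ≡⟨ zipWith-cong (λ x y → sym (φ-hom x y)) xs (rotate xs) ⟩
  zipWith (λ x y → φ (x ⊕ y)) xs (rotate xs)     ≡⟨ map-zipWith _⊕_ φ xs (rotate xs) ⟨
  map φ (sums xs)                                ∎

map-hamCycle : ∀ {ms ms′} (φ : El ms → El ms′) (φ⁻¹ : El ms′ → El ms) →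
  (∀ y → φ (φ⁻¹ y) ≡ y) → (∀ x → φ⁻¹ (φ x) ≡ x) → (∀ x y → φ (x ⊕ y) ≡ φ x ⊕ φ y) →
  (C : HamCycle ms) → ∃ λ (C′ : HamCycle ms′) → |S| C′ ≤ |S| C
map-hamCycle φ φ⁻¹ φ∘φ⁻¹ φ⁻¹∘φ φ-hom C = C′ ,
  subst (|S| C′ ≤_) (length-map φ (deduplicate _≟El_ (sums list))) (|S|≤length C′ sums⊆)
  where
  open HamCycle C
  C′ : HamCycle _
  C′ = record
    { list     = map φ list
    ; distinct = Unique-map⁺ (λ φx≡φy → trans (sym (φ⁻¹∘φ _)) (trans (cong φ⁻¹ φx≡φy) (φ⁻¹∘φ _)))
                             distinct
    ; complete = λ y → subst (_∈ map φ list) (φ∘φ⁻¹ y) (∈-map⁺ φ (complete (φ⁻¹ y)))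
    }
  sums⊆ : sums (map φ list) ⊆ map φ (deduplicate _≟El_ (sums list))
  sums⊆ s∈ with ∈-map⁻ φ (subst (_ ∈_) (sums-map φ φ-hom list) s∈)
  ... | x , x∈ , refl = ∈-map⁺ φ (∈-deduplicate⁺ _≟El_ x∈)

IsSMin-intro : ∀ {ms k} (C : HamCycle ms) → |S| C ≤ k → (∀ (C′ : HamCycle ms) → k ≤ |S| C′) → IsSMin ms k
IsSMin-intro C |S|≤k k≤|S| = (C , ≤-antisym |S|≤k (k≤|S| C)) , k≤|S|

listsOfLength : ∀ {A : Set} → List A → ℕ → List (List A)
listsOfLength xs zero    = [ [] ]
listsOfLength xs (suc n) = cartesianProductWith _∷_ xs (listsOfLength xs n)

∈-listsOfLength : ∀ {A : Set} {xs ys : List A} → ys ⊆ xs → ys ∈ listsOfLength xs (length ys)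
∈-listsOfLength {ys = []}     _     = here refl
∈-listsOfLength {ys = y ∷ ys} ys⊆xs =
  ∈-cartesianProductWith⁺ _∷_ (ys⊆xs (here refl)) (∈-listsOfLength (ys⊆xs ∘ there))

-- Constructively, |S| attains its minimum because all listings of G can be searched.
minimalCycle : ∀ {ms} → HamCycle ms → ∃ λ (C : HamCycle ms) → ∀ (C′ : HamCycle ms) → |S| C ≤ |S| C′
minimalCycle {ms} C₀ = toCycle best best-isCycle , minimal
  where
  open UniqueDec (_≟El_ {ms}) using (unique?)
  open MembershipDec (_≟El_ {ms}) using (_∈?_)

  E = HamCycle.list C₀

  IsCycle : List (El ms) → Set
  IsCycle l = Unique l × All (_∈ l) E

  isCycle? : Decidable IsCycle
  isCycle? l = unique? l ×-dec All.all? (_∈? l) E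

  toCycle : ∀ l → IsCycle l → HamCycle ms
  toCycle l (!l , E⊆l) = record
    { list = l ; distinct = !l ; complete = λ g → All.lookup E⊆l (HamCycle.complete C₀ g) }

  cycle-isCycle : ∀ C → IsCycle (HamCycle.list C)
  cycle-isCycle C = HamCycle.distinct C , All.tabulate (λ {g} _ → HamCycle.complete C g)

  |S|ₗ : List (El ms) → ℕ
  |S|ₗ l = length (deduplicate _≟El_ (sums l))

  candidates : List (List (El ms))
  candidates = filter isCycle? (listsOfLength E (length E))

  best : List (El ms)
  best = argmin |S|ₗ E candidates

  best-isCycle : IsCycle best
  best-isCycle = argmin-all |S|ₗ {E} {candidates} (cycle-isCycle C₀)
    (All.tabulate (proj₂ ∘ ∈-filter⁻ isCycle? {xs = listsOfLength E (length E)}))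

  length≡ : ∀ C → length (HamCycle.list C) ≡ length E
  length≡ C = ≤-antisym (Unique-⊆⇒length≤ (HamCycle.distinct C) (λ {g} _ → HamCycle.complete C₀ g))
                        (Unique-⊆⇒length≤ (HamCycle.distinct C₀) (λ {g} _ → HamCycle.complete C g))

  minimal : ∀ C → |S|ₗ best ≤ |S| C
  minimal C = All.lookup (f[argmin]≤f[xs] E candidates)
    (∈-filter⁺ isCycle? (subst (λ n → HamCycle.list C ∈ listsOfLength E n) (length≡ C)
      (∈-listsOfLength (λ {g} _ → HamCycle.complete C₀ g))) (cycle-isCycle C))

data EvenOdd : ℕ → Set where
  even : ∀ k → EvenOdd (k * 2)
  odd  : ∀ k → EvenOdd (suc (k * 2))

evenOdd : ∀ n → EvenOdd n
evenOdd zero          = even 0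
evenOdd (suc zero)    = odd 0
evenOdd (suc (suc n)) with evenOdd n
... | even k = even (suc k)
... | odd  k = odd (suc k)

evenOdd-even : ∀ k → evenOdd (k * 2) ≡ even k
evenOdd-even zero = refl
evenOdd-even (suc k) rewrite evenOdd-even k = refl

evenOdd-odd : ∀ k → evenOdd (suc (k * 2)) ≡ odd k
evenOdd-odd zero = refl
evenOdd-odd (suc k) rewrite evenOdd-odd k = refl

interleave : ∀ {A : Set} → (ℕ → A) → (ℕ → A) → ℕ → A
interleave a b zero    = a 0
interleave a b (suc i) = interleave b (a ∘ suc) i

interleave-even : ∀ {A : Set} (a b : ℕ → A) k → interleave a b (k * 2) ≡ a k
interleave-even a b zero    = refl
interleave-even a b (suc k) = interleave-even (a ∘ suc) (b ∘ suc) k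

interleave-odd : ∀ {A : Set} (a b : ℕ → A) k → interleave a b (suc (k * 2)) ≡ b k
interleave-odd a b = interleave-even b (a ∘ suc)

parity[k*2]≡0ℙ : ∀ k → parity (k * 2) ≡ 0ℙ
parity[k*2]≡0ℙ zero    = refl
parity[k*2]≡0ℙ (suc k) = parity[k*2]≡0ℙ k

parity-suc : ∀ n → parity (suc n) ≡ parity n ⁻¹
parity-suc n = sym (⁻¹-selfInverse (suc-homo-⁻¹ n))

2∣⇒parity≡0ℙ : ∀ {n} → 2 ∣ n → parity n ≡ 0ℙ
2∣⇒parity≡0ℙ (divides q refl) = parity[k*2]≡0ℙ q

k*2≡k+k : ∀ k → k * 2 ≡ k + k
k*2≡k+k = solve-∀

¬2∣⇒≡1+k*2 : ∀ n → ¬ 2 ∣ n → ∃ λ k → n ≡ suc (k * 2)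
¬2∣⇒≡1+k*2 n ¬2∣n with evenOdd n
... | even k = contradiction (divides k refl) ¬2∣n
... | odd  k = k , refl

-- Upper bounds

evenCandidates : ∀ p ps → List (El (map suc (p ∷ ps)))
evenCandidates p ps = top (p ∷ ps) ∷ map (λ s → top (p ∷ ps) ⊕ ((1ₘ , 0# ps) ⊕ s)) (increments (p ∷ ps))

module EvenCycle (p : ℕ) (ps : List ℕ) (t : ℕ)
                 (p-odd : parity p ≡ 1ℙ) (n≡ : product (map suc (p ∷ ps)) ≡ suc t * 2) where

  qs : List ℕ
  qs = p ∷ ps

  e₁ : El (map suc qs)
  e₁ = 1ₘ , 0# ps

  candidates : List (El (map suc qs))
  candidates = evenCandidates p ps

  a b f : ℕ → El (map suc qs)
  a k = decode qs (k * 2)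
  b k = complement (decode qs (k * 2))
  f   = interleave a b

  digit : El (map suc qs) → ℕ
  digit = toℕ ∘ proj₁

  parity-digit-next : ∀ x → parity (digit (next x)) ≡ parity (digit x) ⁻¹
  parity-digit-next (d , x) with suc (toℕ d) <? suc p
  ... | yes d+1<m = trans (cong parity (toℕ-fromℕ< d+1<m)) (parity-suc (toℕ d))
  ... | no  d+1≮m = sym (cong _⁻¹ (trans (cong parity (toℕ≡max d d+1≮m)) p-odd))

  parity-digit : ∀ i → parity (digit (decode qs i)) ≡ parity i
  parity-digit zero    = refl
  parity-digit (suc i) = begin
    parity (digit (next (decode qs i)))   ≡⟨ parity-digit-next (decode qs i) ⟩
    parity (digit (decode qs i)) ⁻¹       ≡⟨ cong _⁻¹ (parity-digit i) ⟩
    parity i ⁻¹                           ≡⟨ parity-suc i ⟨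
    parity (suc i)                        ∎

  -- The first modulus suc p is even, so an even first digit is not the maximal digit p.
  next-≡⊕e₁ : ∀ x → parity (digit x) ≡ 0ℙ → next x ≡ x ⊕ e₁
  next-≡⊕e₁ (d , x) d-even with suc (toℕ d) <? suc p
  ... | yes d+1<m = cong₂ _,_ (fromℕ<≡+ₘ1ₘ d d+1<m) (sym (⊕-identityʳ ps x))
  ... | no  d+1≮m = contradiction (trans (sym d-even) (trans (cong parity (toℕ≡max d d+1≮m)) p-odd)) λ ()

  next-a : ∀ k → decode qs (suc (k * 2)) ≡ a k ⊕ e₁
  next-a k = next-≡⊕e₁ (a k) (trans (parity-digit (k * 2)) (parity[k*2]≡0ℙ k))

  a⊕b : ∀ k → a k ⊕ b k ≡ top qs
  a⊕b k = trans (⊕-comm (a k) (b k)) (complement-⊕ qs (a k))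

  b⊕a : ∀ k → b k ⊕ a (suc k) ∈ candidates
  b⊕a k with next-increment p ps (a k ⊕ e₁)
  ... | s , s∈ , next≡ = subst (_∈ candidates) (sym sum≡) (there (∈-map⁺ (λ s → top qs ⊕ (e₁ ⊕ s)) s∈))
    where
    sum≡ : b k ⊕ a (suc k) ≡ top qs ⊕ (e₁ ⊕ s)
    sum≡ = begin
      b k ⊕ next (decode qs (suc (k * 2)))   ≡⟨ cong (λ x → b k ⊕ next x) (next-a k) ⟩
      b k ⊕ next (a k ⊕ e₁)                 ≡⟨ cong (b k ⊕_) next≡ ⟩
      b k ⊕ ((a k ⊕ e₁) ⊕ s)                ≡⟨ cong (b k ⊕_) (⊕-assoc (a k) e₁ s) ⟩
      b k ⊕ (a k ⊕ (e₁ ⊕ s))                ≡⟨ ⊕-assoc (b k) (a k) (e₁ ⊕ s) ⟨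
      (b k ⊕ a k) ⊕ (e₁ ⊕ s)                ≡⟨ cong (_⊕ (e₁ ⊕ s)) (complement-⊕ qs (a k)) ⟩
      top qs ⊕ (e₁ ⊕ s)                     ∎

  consecutive : ∀ i → f i ⊕ f (suc i) ∈ candidates
  consecutive i with evenOdd i
  ... | even k rewrite interleave-even a b k | interleave-odd a b k = here (a⊕b k)
  ... | odd  k rewrite interleave-odd a b k | interleave-even a b (suc k) = b⊕a k

  periodic : f (suc t * 2) ≡ f 0
  periodic = begin
    f (suc t * 2)                        ≡⟨ interleave-even a b (suc t) ⟩
    decode qs (suc t * 2)                ≡⟨ cong (decode qs) n≡ ⟨
    decode qs (product (map suc qs))     ≡⟨ decode-product qs ⟩
    0# qs                                ∎

  -- ψ(2k) sits at position 2k and ψ(2k + 1) = ψ(2(t − k))ᶜ at position 2(t − k) + 1.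
  index : ℕ → ℕ
  index v with evenOdd v
  ... | even k = k * 2
  ... | odd  k = suc ((t ∸ k) * 2)

  index-even : ∀ k → index (k * 2) ≡ k * 2
  index-even k rewrite evenOdd-even k = refl

  index-odd : ∀ k → index (suc (k * 2)) ≡ suc ((t ∸ k) * 2)
  index-odd k rewrite evenOdd-odd k = refl

  odd<⇒≤ : ∀ k → suc (k * 2) < product (map suc qs) → k ≤ t
  odd<⇒≤ k lt = *-cancelʳ-≤ k t 2 (s≤s⁻¹ (s≤s⁻¹ (subst (suc (k * 2) <_) n≡ lt)))

  b≡decode : ∀ k → k ≤ t → b k ≡ decode qs (suc ((t ∸ k) * 2))
  b≡decode k k≤t = complement-decode qs (k * 2) (suc ((t ∸ k) * 2)) (begin
    suc (k * 2 + suc ((t ∸ k) * 2))   ≡⟨ regroup k (t ∸ k) ⟩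
    suc (k + (t ∸ k)) * 2             ≡⟨ cong (λ j → suc j * 2) (m+[n∸m]≡n k≤t) ⟩
    suc t * 2                         ≡⟨ n≡ ⟨
    product (map suc qs)              ∎)
    where
    regroup : ∀ k j → suc (k * 2 + suc (j * 2)) ≡ suc (k + j) * 2
    regroup = solve-∀

  [1+[t∸k]*2]<n : ∀ k → suc ((t ∸ k) * 2) < product (map suc qs)
  [1+[t∸k]*2]<n k = subst (suc ((t ∸ k) * 2) <_) (sym n≡) (s≤s (s≤s (*-monoˡ-≤ 2 (m∸n≤m t k))))

  index< : ∀ {v} → v < product (map suc qs) → index v < product (map suc qs)
  index< {v} v<n with evenOdd v
  ... | even k = v<n
  ... | odd  k = [1+[t∸k]*2]<n k

  f∘index : ∀ {v} → v < product (map suc qs) → f (index v) ≡ decode qs v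
  f∘index {v} v<n with evenOdd v
  ... | even k = interleave-even a b k
  ... | odd  k = begin
    f (suc ((t ∸ k) * 2))                  ≡⟨ interleave-odd a b (t ∸ k) ⟩
    b (t ∸ k)                              ≡⟨ b≡decode (t ∸ k) (m∸n≤m t k) ⟩
    decode qs (suc ((t ∸ (t ∸ k)) * 2))    ≡⟨ cong (λ j → decode qs (suc (j * 2))) (m∸[m∸n]≡n (odd<⇒≤ k v<n)) ⟩
    decode qs (suc (k * 2))                ∎

  index∘encode∘f : ∀ {i} → i < product (map suc qs) → index (encode (f i)) ≡ i
  index∘encode∘f {i} i<n with evenOdd i
  ... | even k = begin
    index (encode (f (k * 2)))       ≡⟨ cong (index ∘ encode) (interleave-even a b k) ⟩
    index (encode (a k))             ≡⟨ cong index (encode-decode qs i<n) ⟩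
    index (k * 2)                    ≡⟨ index-even k ⟩
    k * 2                            ∎
  ... | odd  k = begin
    index (encode (f (suc (k * 2))))
      ≡⟨ cong (index ∘ encode) (trans (interleave-odd a b k) (b≡decode k k≤t)) ⟩
    index (encode (decode qs (suc ((t ∸ k) * 2))))
      ≡⟨ cong index (encode-decode qs ([1+[t∸k]*2]<n k)) ⟩
    index (suc ((t ∸ k) * 2))
      ≡⟨ index-odd (t ∸ k) ⟩
    suc ((t ∸ (t ∸ k)) * 2)
      ≡⟨ cong (λ j → suc (j * 2)) (m∸[m∸n]≡n k≤t) ⟩
    suc (k * 2)
      ∎
    where k≤t = odd<⇒≤ k i<n

  cycle : HamCycle (map suc qs)
  cycle = applyUpTo-hamCycle qs f index index< f∘index index∘encode∘f

  sums-cycle-⊆ : sums (HamCycle.list cycle) ⊆ candidates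
  sums-cycle-⊆ = subst (λ n → sums (applyUpTo f n) ⊆ candidates) (sym n≡)
    (sums-applyUpTo-⊆ f (suc (t * 2)) (λ {i} _ → consecutive i)
      (subst (λ x → f (suc (t * 2)) ⊕ x ∈ candidates) periodic (consecutive (suc (t * 2)))))

evenCycle : ∀ p ps → 2 ∣ suc p →
  Σ (HamCycle (map suc (p ∷ ps))) λ C → sums (HamCycle.list C) ⊆ evenCandidates p ps
evenCycle p ps 2∣m with ∣-trans 2∣m (m∣m*n (product (map suc ps)))
... | divides zero    n≡ = contradiction (sym n≡) (<⇒≢ (product>0 (p ∷ ps)))
... | divides (suc t) n≡ = EvenCycle.cycle p ps t p-odd n≡ , EvenCycle.sums-cycle-⊆ p ps t p-odd n≡
  where
  p-odd : parity p ≡ 1ℙ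
  p-odd = trans (sym (suc-homo-⁻¹ p)) (cong _⁻¹ (2∣⇒parity≡0ℙ 2∣m))

firstEven-|S|≤1+rank : ∀ p ps → 2 ∣ suc p → ∃ λ (C : HamCycle (map suc (p ∷ ps))) → |S| C ≤ suc (length (p ∷ ps))
firstEven-|S|≤1+rank p ps 2∣m with evenCycle p ps 2∣m
... | C , sums⊆ = C , ≤-trans (|S|≤length C sums⊆)
  (≤-reflexive (cong suc (trans (length-map _ (increments (p ∷ ps))) (length-increments (p ∷ ps)))))

ℤ₂-|S|≤rank : ∀ ps → ∃ λ (C : HamCycle (map suc (1 ∷ ps))) → |S| C ≤ length (1 ∷ ps)
ℤ₂-|S|≤rank ps with evenCycle 1 ps (divides 1 refl)
... | C , sums⊆ = C , ≤-trans (|S|≤length C (shrink ∘ sums⊆))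
  (≤-reflexive (cong suc (trans (length-map (λ s → T ⊕ (e₁ ⊕ s)) (map (1ₘ ,_) (increments ps)))
                                (suc-injective (length-increments (1 ∷ ps))))))
  where
  T = top (1 ∷ ps)
  e₁ : El (map suc (1 ∷ ps))
  e₁ = 1ₘ , 0# ps
  T⊕[e₁⊕e₁]≡T : T ⊕ (e₁ ⊕ e₁) ≡ T
  T⊕[e₁⊕e₁]≡T = trans (cong (λ x → T ⊕ (Fin.zero , x)) (⊕-identityʳ ps (0# ps))) (⊕-identityʳ (1 ∷ ps) T)
  shrink : evenCandidates 1 ps ⊆ T ∷ map (λ s → T ⊕ (e₁ ⊕ s)) (map (1ₘ ,_) (increments ps))
  shrink (here eq)         = here eq
  shrink (there (here eq)) = here (trans eq T⊕[e₁⊕e₁]≡T)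
  shrink (there (there q)) = there q

module _ (y : ℕ) (zs : List ℕ) where

  toFront : ∀ xs → El (map suc (xs ++ y ∷ zs)) → El (map suc (y ∷ xs ++ zs))
  toFront []       g       = g
  toFront (x ∷ xs) (a , g) = proj₁ (toFront xs g) , a , proj₂ (toFront xs g)

  fromFront : ∀ xs → El (map suc (y ∷ xs ++ zs)) → El (map suc (xs ++ y ∷ zs))
  fromFront []       g           = g
  fromFront (x ∷ xs) (b , a , g) = a , fromFront xs (b , g)

  fromFront∘toFront : ∀ xs g → fromFront xs (toFront xs g) ≡ g
  fromFront∘toFront []       g       = refl
  fromFront∘toFront (x ∷ xs) (a , g) = cong (a ,_) (fromFront∘toFront xs g)

  toFront∘fromFront : ∀ xs g → toFront xs (fromFront xs g) ≡ g
  toFront∘fromFront []       g           = refl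
  toFront∘fromFront (x ∷ xs) (b , a , g) rewrite toFront∘fromFront xs (b , g) = refl

  fromFront-⊕ : ∀ xs g h → fromFront xs (g ⊕ h) ≡ fromFront xs g ⊕ fromFront xs h
  fromFront-⊕ []       g           h              = refl
  fromFront-⊕ (x ∷ xs) (b , a , g) (b′ , a′ , h) = cong (a +ₘ a′ ,_) (fromFront-⊕ xs (b , g) (b′ , h))

2∣product⇒even-modulus : ∀ qs → 2 ∣ product (map suc qs) →
  ∃₂ λ xs zs → ∃ λ y → qs ≡ xs ++ y ∷ zs × 2 ∣ suc y
2∣product⇒even-modulus []       2∣1 = contradiction (∣1⇒≡1 2∣1) λ ()
2∣product⇒even-modulus (q ∷ qs) 2∣n with euclidsLemma (suc q) (product (map suc qs)) prime[2] 2∣n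
... | inj₁ 2∣m = [] , qs , q , refl , 2∣m
... | inj₂ 2∣n′ with 2∣product⇒even-modulus qs 2∣n′
...   | xs , zs , y , refl , 2∣y = q ∷ xs , zs , y , refl , 2∣y

length-++-∷ : ∀ {A : Set} xs (y : A) zs → length (xs ++ y ∷ zs) ≡ suc (length (xs ++ zs))
length-++-∷ xs y zs = begin
  length (xs ++ y ∷ zs)              ≡⟨ length-++ xs ⟩
  length xs + suc (length zs)        ≡⟨ +-suc (length xs) (length zs) ⟩
  suc (length xs + length zs)        ≡⟨ cong suc (length-++ xs) ⟨
  suc (length (xs ++ zs))            ∎

evenOrder-|S|≤1+rank : ∀ qs → 2 ∣ product (map suc qs) →
  ∃ λ (C : HamCycle (map suc qs)) → |S| C ≤ suc (length qs)
evenOrder-|S|≤1+rank qs 2∣n with 2∣product⇒even-modulus qs 2∣n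
... | xs , zs , y , refl , 2∣y with firstEven-|S|≤1+rank y (xs ++ zs) 2∣y
...   | C , |S|≤ with map-hamCycle (fromFront y zs xs) (toFront y zs xs)
                       (fromFront∘toFront y zs xs) (toFront∘fromFront y zs xs) (fromFront-⊕ y zs xs) C
...     | C′ , |S′|≤ = C′ , ≤-trans |S′|≤ (≤-trans |S|≤ (≤-reflexive (cong suc (sym (length-++-∷ xs y zs)))))

t∸[1+[t∸[1+k]]]≡k : ∀ {t k} → k < t → t ∸ suc (t ∸ suc k) ≡ k
t∸[1+[t∸[1+k]]]≡k {t} {k} k<t = trans (cong (t ∸_) (sym (+-∸-assoc 1 k<t))) (m∸[m∸n]≡n (<⇒≤ k<t))

oddCandidates : ∀ p ps → ℕ → List (El (map suc (p ∷ ps)))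
oddCandidates p ps t = top qs ∷ (top qs ⊕ decode qs t) ∷ map (top qs ⊖_) (increments qs)
  where qs = p ∷ ps

module OddCycle (p : ℕ) (ps : List ℕ) (t : ℕ) (n≡ : product (map suc (p ∷ ps)) ≡ suc (t * 2)) where

  qs : List ℕ
  qs = p ∷ ps

  candidates : List (El (map suc qs))
  candidates = oddCandidates p ps t

  a b f : ℕ → El (map suc qs)
  a k = decode qs (t + k)
  b k = complement (decode qs (t + suc k))
  f   = interleave a b

  a⊕b : ∀ k → a k ⊕ b k ∈ candidates
  a⊕b k with next-increment p ps (a k)
  ... | s , s∈ , next≡ = subst (_∈ candidates) (sym sum≡) (there (there (∈-map⁺ (top qs ⊖_) s∈)))
    where
    sum≡ : a k ⊕ b k ≡ top qs ⊖ s
    sum≡ = begin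
      a k ⊕ complement (decode qs (t + suc k))   ≡⟨ cong (λ i → a k ⊕ complement (decode qs i)) (+-suc t k) ⟩
      a k ⊕ complement (next (a k))              ≡⟨ cong (λ x → a k ⊕ complement x) next≡ ⟩
      a k ⊕ complement (a k ⊕ s)                 ≡⟨ cong (a k ⊕_) (⊕≡⇒≡⊖ (complement-⊕ qs (a k ⊕ s))) ⟩
      a k ⊕ (top qs ⊖ (a k ⊕ s))                 ≡⟨ x⊕[y⊖[x⊕z]]≡y⊖z (a k) (top qs) s ⟩
      top qs ⊖ s                                 ∎

  b⊕a : ∀ k → b k ⊕ a (suc k) ≡ top qs
  b⊕a k = complement-⊕ qs (a (suc k))

  consecutive : ∀ i → f i ⊕ f (suc i) ∈ candidates
  consecutive i with evenOdd i
  ... | even k rewrite interleave-even a b k | interleave-odd a b k = a⊕b k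
  ... | odd  k rewrite interleave-odd a b k | interleave-even a b (suc k) = here (b⊕a k)

  last : f (t * 2) ⊕ f 0 ∈ candidates
  last = there (here (cong₂ _⊕_ a[t]≡top (cong (decode qs) (+-identityʳ t))))
    where
    a[t]≡top : f (t * 2) ≡ top qs
    a[t]≡top = trans (interleave-even a b t) (decode-top qs (trans (cong suc (sym (k*2≡k+k t))) (sym n≡)))

  -- ψ(t + k) sits at position 2k and ψ(t − 1 − k) = ψ(t + 1 + k)ᶜ at position 2k + 1.
  index : ℕ → ℕ
  index v with t ≤? v
  ... | yes _ = (v ∸ t) * 2
  ... | no  _ = suc ((t ∸ suc v) * 2)

  index-a : ∀ k → index (t + k) ≡ k * 2
  index-a k with t ≤? t + k
  ... | yes _   = cong (_* 2) (m+n∸m≡n t k)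
  ... | no  t≰  = contradiction (m≤m+n t k) t≰

  index-b : ∀ {k} → k < t → index (t ∸ suc k) ≡ suc (k * 2)
  index-b {k} k<t with t ≤? t ∸ suc k
  ... | yes t≤  = contradiction t≤ (<⇒≱ (∸-monoʳ-< {t} {suc k} {0} z<s k<t))
  ... | no  _   = cong (λ j → suc (j * 2)) (t∸[1+[t∸[1+k]]]≡k k<t)

  b≡decode : ∀ {k} → k < t → b k ≡ decode qs (t ∸ suc k)
  b≡decode {k} k<t = complement-decode qs (t + suc k) (t ∸ suc k) (begin
    suc (t + suc k + (t ∸ suc k))      ≡⟨ cong suc (+-assoc t (suc k) (t ∸ suc k)) ⟩
    suc (t + (suc k + (t ∸ suc k)))    ≡⟨ cong (λ j → suc (t + j)) (m+[n∸m]≡n k<t) ⟩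
    suc (t + t)                        ≡⟨ cong suc (k*2≡k+k t) ⟨
    suc (t * 2)                        ≡⟨ n≡ ⟨
    product (map suc qs)               ∎)

  even<⇒≤ : ∀ k → k * 2 < product (map suc qs) → k ≤ t
  even<⇒≤ k lt = *-cancelʳ-≤ k t 2 (s≤s⁻¹ (subst (k * 2 <_) n≡ lt))

  odd<⇒< : ∀ k → suc (k * 2) < product (map suc qs) → k < t
  odd<⇒< k lt = *-cancelʳ-< 2 k t (s≤s⁻¹ (subst (suc (k * 2) <_) n≡ lt))

  t+k<n : ∀ {k} → k ≤ t → t + k < product (map suc qs)
  t+k<n {k} k≤t = subst (t + k <_) (sym n≡) (s≤s (subst (t + k ≤_) (sym (k*2≡k+k t)) (+-monoʳ-≤ t k≤t)))

  t∸[1+k]<n : ∀ k → t ∸ suc k < product (map suc qs)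
  t∸[1+k]<n k = subst (t ∸ suc k <_) (sym n≡)
    (s≤s (≤-trans (m∸n≤m t (suc k)) (subst (t ≤_) (sym (k*2≡k+k t)) (m≤m+n t t))))

  index< : ∀ {v} → v < product (map suc qs) → index v < product (map suc qs)
  index< {v} v<n with t ≤? v
  ... | yes t≤v = subst ((v ∸ t) * 2 <_) (sym n≡)
    (s≤s (*-monoˡ-≤ 2 (m≤n+o⇒m∸n≤o v t (subst (v ≤_) (k*2≡k+k t) (s≤s⁻¹ (subst (v <_) n≡ v<n))))))
  ... | no  t≰v = subst (suc ((t ∸ suc v) * 2) <_) (sym n≡)
    (s≤s (*-monoˡ-< 2 (∸-monoʳ-< {t} {suc v} {0} z<s (≰⇒> t≰v))))

  f∘index : ∀ {v} → v < product (map suc qs) → f (index v) ≡ decode qs v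
  f∘index {v} v<n with t ≤? v
  ... | yes t≤v = trans (interleave-even a b (v ∸ t)) (cong (decode qs) (m+[n∸m]≡n t≤v))
  ... | no  t≰v = begin
    f (suc ((t ∸ suc v) * 2))          ≡⟨ interleave-odd a b (t ∸ suc v) ⟩
    b (t ∸ suc v)                      ≡⟨ b≡decode (∸-monoʳ-< {t} {suc v} {0} z<s v<t) ⟩
    decode qs (t ∸ suc (t ∸ suc v))    ≡⟨ cong (decode qs) (t∸[1+[t∸[1+k]]]≡k v<t) ⟩
    decode qs v                        ∎
    where v<t = ≰⇒> t≰v

  index∘encode∘f : ∀ {i} → i < product (map suc qs) → index (encode (f i)) ≡ i
  index∘encode∘f {i} i<n with evenOdd i
  ... | even k = begin
    index (encode (f (k * 2)))   ≡⟨ cong (index ∘ encode) (interleave-even a b k) ⟩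
    index (encode (a k))         ≡⟨ cong index (encode-decode qs (t+k<n (even<⇒≤ k i<n))) ⟩
    index (t + k)                ≡⟨ index-a k ⟩
    k * 2                        ∎
  ... | odd  k = begin
    index (encode (f (suc (k * 2))))        ≡⟨ cong (index ∘ encode) (trans (interleave-odd a b k) (b≡decode k<t)) ⟩
    index (encode (decode qs (t ∸ suc k)))  ≡⟨ cong index (encode-decode qs (t∸[1+k]<n k)) ⟩
    index (t ∸ suc k)                       ≡⟨ index-b k<t ⟩
    suc (k * 2)                             ∎
    where k<t = odd<⇒< k i<n

  cycle : HamCycle (map suc qs)
  cycle = applyUpTo-hamCycle qs f index index< f∘index index∘encode∘f

  sums-cycle-⊆ : sums (HamCycle.list cycle) ⊆ candidates
  sums-cycle-⊆ = subst (λ n → sums (applyUpTo f n) ⊆ candidates) (sym n≡)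
    (sums-applyUpTo-⊆ f (t * 2) (λ {i} _ → consecutive i) last)

oddOrder-|S|≤2+rank : ∀ p ps → ¬ 2 ∣ product (map suc (p ∷ ps)) →
  ∃ λ (C : HamCycle (map suc (p ∷ ps))) → |S| C ≤ suc (suc (length (p ∷ ps)))
oddOrder-|S|≤2+rank p ps ¬2∣n with ¬2∣⇒≡1+k*2 _ ¬2∣n
... | t , n≡ = C , ≤-trans (|S|≤length C (OddCycle.sums-cycle-⊆ p ps t n≡))
  (≤-reflexive (cong (suc ∘ suc) (trans (length-map _ (increments (p ∷ ps))) (length-increments (p ∷ ps)))))
  where C = OddCycle.cycle p ps t n≡

-- Lower bound

module Reduction (p : ℕ) where

  reduceₘ : ∀ {q} → Fin (suc q) → Fin (suc p)
  reduceₘ a = fromℕ< (m%n<n (toℕ a) (suc p))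

  toℕ-reduceₘ : ∀ {q} (a : Fin (suc q)) → toℕ (reduceₘ a) ≡ toℕ a % suc p
  toℕ-reduceₘ a = toℕ-fromℕ< _

  reduceₘ-+ₘ : ∀ {q} → suc p ∣ suc q → (a b : Fin (suc q)) → reduceₘ (a +ₘ b) ≡ reduceₘ a +ₘ reduceₘ b
  reduceₘ-+ₘ {q} m∣ a b = toℕ-injective (begin
    toℕ (reduceₘ (a +ₘ b))                        ≡⟨ toℕ-reduceₘ (a +ₘ b) ⟩
    toℕ (a +ₘ b) % m                              ≡⟨ cong (_% m) (toℕ-+ₘ a b) ⟩
    (toℕ a + toℕ b) % suc q % m                   ≡⟨ m∣n⇒o%n%m≡o%m m (suc q) (toℕ a + toℕ b) m∣ ⟩
    (toℕ a + toℕ b) % m                           ≡⟨ %-distribˡ-+ (toℕ a) (toℕ b) m ⟩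
    (toℕ a % m + toℕ b % m) % m
      ≡⟨ cong₂ (λ x y → (x + y) % m) (toℕ-reduceₘ a) (toℕ-reduceₘ b) ⟨
    (toℕ (reduceₘ a) + toℕ (reduceₘ b)) % m       ≡⟨ toℕ-+ₘ (reduceₘ a) (reduceₘ b) ⟨
    toℕ (reduceₘ a +ₘ reduceₘ b)                  ∎)
    where m = suc p

  reduce : ∀ qs → El (map suc qs) → El (map suc (replicate (length qs) p))
  reduce []       tt      = tt
  reduce (q ∷ qs) (a , x) = reduceₘ a , reduce qs x

  reduce-⊕ : ∀ {qs} → All (suc p ∣_) (map suc qs) → ∀ x y → reduce qs (x ⊕ y) ≡ reduce qs x ⊕ reduce qs y
  reduce-⊕ {[]}     []         tt      tt      = refl
  reduce-⊕ {q ∷ qs} (m∣ ∷ m∣s) (a , x) (b , y) = cong₂ _,_ (reduceₘ-+ₘ m∣ a b) (reduce-⊕ m∣s x y)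

  reduce-surjective : ∀ {qs} → All (suc p ∣_) (map suc qs) → ∀ v → ∃ λ g → reduce qs g ≡ v
  reduce-surjective {[]}     []         tt      = tt , refl
  reduce-surjective {q ∷ qs} (m∣ ∷ m∣s) (b , v) with reduce-surjective m∣s v
  ... | g , g↦v = (fromℕ< b<q , g) , cong₂ _,_ b↦b g↦v
    where
    b<q : toℕ b < suc q
    b<q = <-≤-trans (toℕ<n b) (∣⇒≤ m∣)
    b↦b : reduceₘ (fromℕ< b<q) ≡ b
    b↦b = toℕ-injective (trans (toℕ-reduceₘ (fromℕ< b<q))
                          (trans (cong (_% suc p) (toℕ-fromℕ< b<q)) (m<n⇒m%n≡m (toℕ<n b))))

infixr 25 _·_
_·_ : ∀ {ps} → ℕ → El (map suc ps) → El (map suc ps)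
_·_ {ps} zero    x = 0# ps
_·_      (suc c) x = x ⊕ c · x

infixr 25 _·ₘ_
_·ₘ_ : ∀ {k} → ℕ → Fin (suc k) → Fin (suc k)
zero  ·ₘ a = Fin.zero
suc c ·ₘ a = a +ₘ c ·ₘ a

toℕ-·ₘ : ∀ {k} c (a : Fin (suc k)) → toℕ (c ·ₘ a) ≡ (c * toℕ a) % suc k
toℕ-·ₘ zero    a = refl
toℕ-·ₘ {k} (suc c) a = begin
  toℕ (a +ₘ c ·ₘ a)                  ≡⟨ toℕ-+ₘ a (c ·ₘ a) ⟩
  (toℕ a + toℕ (c ·ₘ a)) % suc k     ≡⟨ cong (λ x → (toℕ a + x) % suc k) (toℕ-·ₘ c a) ⟩
  (toℕ a + c * toℕ a % suc k) % suc k ≡⟨ [m+n%d]%d≡[m+n]%d (toℕ a) (c * toℕ a) (suc k) ⟩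
  (toℕ a + c * toℕ a) % suc k        ∎

·-pointwise : ∀ {p ps} c (a : Fin (suc p)) (x : El (map suc ps)) → _·_ {p ∷ ps} c (a , x) ≡ (c ·ₘ a , c · x)
·-pointwise zero    a x = refl
·-pointwise (suc c) a x = cong ((a , x) ⊕_) (·-pointwise c a x)

[1+p]·x≡0# : ∀ p r (x : El (map suc (replicate r p))) → suc p · x ≡ 0# (replicate r p)
[1+p]·x≡0# p zero    tt      = refl
[1+p]·x≡0# p (suc r) (a , x) = trans (·-pointwise (suc p) a x) (cong₂ _,_ m·a≡0 ([1+p]·x≡0# p r x))
  where
  m·a≡0 : suc p ·ₘ a ≡ Fin.zero
  m·a≡0 = toℕ-injective (trans (toℕ-·ₘ (suc p) a)
                          (trans (cong (_% suc p) (*-comm (suc p) (toℕ a))) (m*n%n≡0 (toℕ a) (suc p))))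

length-cartesianProductWith : ∀ {A B C : Set} (f : A → B → C) xs ys →
  length (cartesianProductWith f xs ys) ≡ length xs * length ys
length-cartesianProductWith f []       ys = refl
length-cartesianProductWith f (x ∷ xs) ys = begin
  length (map (f x) ys ++ cartesianProductWith f xs ys)
    ≡⟨ length-++ (map (f x) ys) ⟩
  length (map (f x) ys) + length (cartesianProductWith f xs ys)
    ≡⟨ cong₂ _+_ (length-map (f x) ys) (length-cartesianProductWith f xs ys) ⟩
  length ys + length xs * length ys
    ∎

module Span {ps : List ℕ} (p : ℕ) (m·x≡0# : ∀ (x : El (map suc ps)) → suc p · x ≡ 0# ps) where

  private
    𝔾 = ⊕-abelianGroup ps
  open AbelianGroup 𝔾 using (assoc; identityʳ; commutativeSemigroup)
  open AbelianGroupProperties 𝔾 using (inverseʳ-unique)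
  open CommutativeSemigroupProperties commutativeSemigroup using (xy∙z≈zx∙y; xy∙z≈x∙zy)

  span : List (El (map suc ps)) → List (El (map suc ps))
  span []       = [ 0# ps ]
  span (d ∷ ds) = cartesianProductWith _⊕_ (applyUpTo (_· d) (suc p)) (span ds)

  length-span : ∀ ds → length (span ds) ≡ suc p ^ length ds
  length-span []       = refl
  length-span (d ∷ ds) = begin
    length (span (d ∷ ds))
      ≡⟨ length-cartesianProductWith _⊕_ (applyUpTo (_· d) (suc p)) (span ds) ⟩
    length (applyUpTo (_· d) (suc p)) * length (span ds)
      ≡⟨ cong₂ _*_ (length-applyUpTo (_· d) (suc p)) (length-span ds) ⟩
    suc p * suc p ^ length ds
      ∎

  0#∈span : ∀ ds → 0# ps ∈ span ds
  0#∈span []       = here refl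
  0#∈span (d ∷ ds) = subst (_∈ span (d ∷ ds)) (identityʳ (0# ps))
    (∈-cartesianProductWith⁺ _⊕_ (∈-applyUpTo⁺ (_· d) (z<s {p})) (0#∈span ds))

  span-⊕ : ∀ {ds d z} → d ∈ ds → z ∈ span ds → z ⊕ d ∈ span ds
  span-⊕ {d′ ∷ ds} {d} {z} d∈ z∈ with ∈-cartesianProductWith⁻ _⊕_ (applyUpTo (_· d′) (suc p)) (span ds) z∈
  ... | a , y , a∈ , y∈ , refl with ∈-applyUpTo⁻ (_· d′) a∈ | d∈
  ...   | c , c<m , refl | there d∈ds =
    subst (_∈ span (d′ ∷ ds)) (sym (assoc (c · d′) y d))
      (∈-cartesianProductWith⁺ _⊕_ a∈ (span-⊕ d∈ds y∈))
  ...   | c , c<m , refl | here refl with suc c <? suc p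
  ...     | yes c+1<m = subst (_∈ span (d′ ∷ ds)) (sym (xy∙z≈zx∙y (c · d′) y d′))
      (∈-cartesianProductWith⁺ _⊕_ (∈-applyUpTo⁺ (_· d′) c+1<m) y∈)
  ...     | no  c+1≮m = subst (_∈ span (d′ ∷ ds)) (sym wraps)
      (∈-cartesianProductWith⁺ _⊕_ (∈-applyUpTo⁺ (_· d′) (z<s {p})) y∈)
    where
    wraps : (c · d′ ⊕ y) ⊕ d′ ≡ 0 · d′ ⊕ y
    wraps = trans (xy∙z≈zx∙y (c · d′) y d′)
      (cong (_⊕ y) (trans (cong (_· d′) (≤-antisym c<m (≮⇒≥ c+1≮m))) (m·x≡0# d′)))

  span-⊕· : ∀ {ds d z} c → d ∈ ds → z ∈ span ds → z ⊕ c · d ∈ span ds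
  span-⊕· {ds} {d} {z} zero    d∈ z∈ = subst (_∈ span ds) (sym (identityʳ z)) z∈
  span-⊕· {ds} {d} {z} (suc c) d∈ z∈ =
    subst (_∈ span ds) (xy∙z≈x∙zy z (c · d) d) (span-⊕ d∈ (span-⊕· c d∈ z∈))

  span-⊖ : ∀ {ds d z} → d ∈ ds → z ∈ span ds → z ⊖ d ∈ span ds
  span-⊖ {ds} {d} {z} d∈ z∈ =
    subst (λ w → z ⊕ w ∈ span ds) (inverseʳ-unique d (p · d) (m·x≡0# d)) (span-⊕· p d∈ z∈)

Linked-alternating : ∀ {A B : Set} {R : A → A → Set} (P : B → A → Set) →
  (∀ {x y w b} → R x y → R y w → P b x → P b w) →
  ∀ {x y zs b b′} → Linked R (x ∷ y ∷ zs) → P b x → P b′ y → All (λ g → P b g ⊎ P b′ g) (x ∷ y ∷ zs)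
Linked-alternating P step {zs = []}     _               px py = inj₁ px ∷ inj₂ py ∷ []
Linked-alternating P step {zs = w ∷ zs} (rxy ∷ ryw ∷ rs) px py =
  inj₁ px ∷ All.map Sum.swap (Linked-alternating P step (ryw ∷ rs) py (step rxy ryw px))

sums-Linked : ∀ {ms} (xs : List (El ms)) → Linked (λ x y → x ⊕ y ∈ sums xs) xs
sums-Linked []       = []
sums-Linked (x ∷ xs) = shifted x xs
  where
  shifted : ∀ y ys → Linked (λ u v → u ⊕ v ∈ zipWith _⊕_ (y ∷ ys) (ys ++ [ x ])) (y ∷ ys)
  shifted y []       = [-]
  shifted y (z ∷ zs) = here refl ∷ Linked.map there (shifted z zs)

product-replicate : ∀ r p → product (map suc (replicate r p)) ≡ suc p ^ r
product-replicate zero    p = refl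
product-replicate (suc r) p = cong (suc p *_) (product-replicate r p)

1ₘ≢0 : ∀ {p} → 1 ≤ p → 1ₘ {p} ≢ Fin.zero
1ₘ≢0 {p} 1≤p 1≡0 =
  contradiction (trans (sym (m<n⇒m%n≡m (s≤s 1≤p))) (trans (sym (toℕ-fromℕ< _)) (cong toℕ 1≡0))) λ ()

module LowerBound (p : ℕ) (ps : List ℕ) (m∣ : All (suc p ∣_) (map suc (p ∷ ps))) where

  open Reduction p

  qs : List ℕ
  qs = p ∷ ps

  r : ℕ
  r = length qs

  ws : List ℕ
  ws = replicate r p

  open Span {ws} p ([1+p]·x≡0# p r)

  π : El (map suc qs) → El (map suc ws)
  π = reduce qs

  module _ (u₁ : El (map suc qs)) (U′ : List (El (map suc qs))) where

    D : El (map suc qs) → El (map suc ws)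
    D u = π u ⊖ π u₁

    InCoset : El (map suc ws) → El (map suc qs) → Set
    InCoset b g = ∃ λ z → z ∈ span (map D U′) × π g ≡ b ⊕ z

    span-±D : ∀ {u z} → u ∈ u₁ ∷ U′ → z ∈ span (map D U′) →
      (z ⊕ D u ∈ span (map D U′)) × (z ⊖ D u ∈ span (map D U′))
    span-±D {z = z} (here refl) z∈ = subst (_∈ _) (sym z⊕D[u₁]≡z) z∈ , subst (_∈ _) (sym z⊖D[u₁]≡z) z∈
      where
      open AbelianGroup (⊕-abelianGroup ws) using (identityʳ)
      open AbelianGroupProperties (⊕-abelianGroup ws) using (ε⁻¹≈ε)
      D[u₁]≡0# : D u₁ ≡ 0# ws
      D[u₁]≡0# = ⊕-inverseʳ ws (π u₁)
      z⊕D[u₁]≡z : z ⊕ D u₁ ≡ z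
      z⊕D[u₁]≡z = trans (cong (z ⊕_) D[u₁]≡0#) (identityʳ z)
      z⊖D[u₁]≡z : z ⊖ D u₁ ≡ z
      z⊖D[u₁]≡z = trans (cong (λ d → z ⊕ - d) D[u₁]≡0#) (trans (cong (z ⊕_) ε⁻¹≈ε) (identityʳ z))
    span-±D (there u∈) z∈ = span-⊕ (∈-map⁺ D u∈) z∈ , span-⊖ (∈-map⁺ D u∈) z∈

    coset-step : ∀ {x y w b} → x ⊕ y ∈ u₁ ∷ U′ → y ⊕ w ∈ u₁ ∷ U′ → InCoset b x → InCoset b w
    coset-step {x} {y} {w} {b} xy∈ yw∈ (z , z∈ , πx≡) =
      (z ⊕ D (y ⊕ w)) ⊖ D (x ⊕ y) , proj₂ (span-±D xy∈ (proj₁ (span-±D yw∈ z∈))) , πw≡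
      where
      πw≡ : π w ≡ b ⊕ ((z ⊕ D (y ⊕ w)) ⊖ D (x ⊕ y))
      πw≡ = begin
        π w                                ≡⟨ [x⊕y]⊖x≡y (π y) (π w) ⟨
        (π y ⊕ π w) ⊖ π y                  ≡⟨ cong (_⊖ π y) (reduce-⊕ m∣ y w) ⟨
        π (y ⊕ w) ⊖ π y                    ≡⟨ x⊕[y⊖[x⊕z]]≡y⊖z (π x) (π (y ⊕ w)) (π y) ⟨
        π x ⊕ (π (y ⊕ w) ⊖ (π x ⊕ π y))    ≡⟨ cong (λ v → π x ⊕ (π (y ⊕ w) ⊖ v)) (reduce-⊕ m∣ x y) ⟨
        π x ⊕ (π (y ⊕ w) ⊖ π (x ⊕ y))      ≡⟨ cong (π x ⊕_) ([x⊖z]⊖[y⊖z]≡x⊖y (π (y ⊕ w)) (π (x ⊕ y)) (π u₁)) ⟨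
        π x ⊕ (D (y ⊕ w) ⊖ D (x ⊕ y))      ≡⟨ cong (_⊕ (D (y ⊕ w) ⊖ D (x ⊕ y))) πx≡ ⟩
        (b ⊕ z) ⊕ (D (y ⊕ w) ⊖ D (x ⊕ y))  ≡⟨ ⊕-assoc b z _ ⟩
        b ⊕ (z ⊕ (D (y ⊕ w) ⊖ D (x ⊕ y)))  ≡⟨ cong (b ⊕_) (⊕-assoc z (D (y ⊕ w)) _) ⟨
        b ⊕ ((z ⊕ D (y ⊕ w)) ⊖ D (x ⊕ y))  ∎

    two-cosets : ∀ g₁ g₂ rest → (∀ g → g ∈ g₁ ∷ g₂ ∷ rest) → sums (g₁ ∷ g₂ ∷ rest) ⊆ u₁ ∷ U′ →
      suc p ^ r ≤ 2 * suc p ^ length U′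
    two-cosets g₁ g₂ rest complete sums⊆ = subst₂ _≤_ length-counting length-cosets
      (Unique-⊆⇒length≤ (HamCycle.distinct (countingCycle ws)) (λ {v} _ → covered v))
      where
      S = span (map D U′)
      cosets = map (π g₁ ⊕_) S ++ map (π g₂ ⊕_) S

      length-counting : length (HamCycle.list (countingCycle ws)) ≡ suc p ^ r
      length-counting = trans (length-applyUpTo (decode ws) _) (product-replicate r p)

      length-cosets : length cosets ≡ 2 * suc p ^ length U′
      length-cosets = begin
        length cosets                                        ≡⟨ length-++ (map (π g₁ ⊕_) S) ⟩
        length (map (π g₁ ⊕_) S) + length (map (π g₂ ⊕_) S)  ≡⟨ cong₂ _+_ (length-map _ S) (length-map _ S) ⟩
        length S + length S                                  ≡⟨ cong (λ n → n + n) length-S ⟩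
        suc p ^ length U′ + suc p ^ length U′                ≡⟨ k*2≡k+k (suc p ^ length U′) ⟨
        suc p ^ length U′ * 2                                ≡⟨ *-comm (suc p ^ length U′) 2 ⟩
        2 * suc p ^ length U′                                ∎
        where length-S = trans (length-span (map D U′)) (cong (suc p ^_) (length-map D U′))

      alternating : All (λ g → InCoset (π g₁) g ⊎ InCoset (π g₂) g) (g₁ ∷ g₂ ∷ rest)
      alternating = Linked-alternating InCoset (λ {x} {y} {w} {b} → coset-step {x} {y} {w} {b})
        {b = π g₁} {b′ = π g₂} (Linked.map sums⊆ (sums-Linked (g₁ ∷ g₂ ∷ rest)))
        (0# ws , 0#∈span (map D U′) , sym (⊕-identityʳ ws (π g₁)))
        (0# ws , 0#∈span (map D U′) , sym (⊕-identityʳ ws (π g₂)))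

      covered : ∀ v → v ∈ cosets
      covered v with reduce-surjective m∣ v
      ... | g , refl with All.lookup alternating (complete g)
      ...   | inj₁ (z , z∈ , πg≡) = subst (_∈ cosets) (sym πg≡) (∈-++⁺ˡ (∈-map⁺ (π g₁ ⊕_) z∈))
      ...   | inj₂ (z , z∈ , πg≡) =
        subst (_∈ cosets) (sym πg≡) (∈-++⁺ʳ (map (π g₁ ⊕_) S) (∈-map⁺ (π g₂ ⊕_) z∈))

  |S|-lowerBound : 1 ≤ p → (C : HamCycle (map suc qs)) → suc p ^ suc r ≤ 2 * suc p ^ |S| C
  |S|-lowerBound 1≤p C = bound (HamCycle.list C) (HamCycle.complete C)
    where
    shift : ∀ {j} → suc p ^ r ≤ 2 * suc p ^ j → suc p ^ suc r ≤ 2 * suc p ^ suc j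
    shift {j} le = ≤-trans (*-monoʳ-≤ (suc p) le) (≤-reflexive (swap (suc p) 2 (suc p ^ j)))
      where
      swap : ∀ x y z → x * (y * z) ≡ y * (x * z)
      swap = solve-∀
    bound : ∀ l → (∀ g → g ∈ l) → suc p ^ suc r ≤ 2 * suc p ^ length (deduplicate _≟El_ (sums l))
    bound []                complete = contradiction (complete (0# qs)) λ ()
    bound (g ∷ [])          complete with complete (0# qs) | complete (1ₘ , 0# ps)
    ... | here refl | here e₁≡0# = contradiction (cong proj₁ e₁≡0#) (1ₘ≢0 1≤p)
    bound (g₁ ∷ g₂ ∷ rest) complete =
      shift {length U′} (two-cosets (g₁ ⊕ g₂) U′ g₁ g₂ rest complete (∈-deduplicate⁺ _≟El_))
      where
      -- deduplicate keeps the first sum g₁ ⊕ g₂ in front.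
      U′ = drop 1 (deduplicate _≟El_ (sums (g₁ ∷ g₂ ∷ rest)))

^-cancelʳ-< : ∀ m .{{_ : NonZero m}} {a b} → m ^ a < m ^ b → a < b
^-cancelʳ-< m {a} {b} lt with a <? b
... | yes a<b = a<b
... | no  a≮b = contradiction (^-monoʳ-≤ m (≮⇒≥ a≮b)) (<⇒≱ lt)

2^[1+r]≤2*2^s⇒r≤s : ∀ r s → 2 ^ suc r ≤ 2 * 2 ^ s → r ≤ s
2^[1+r]≤2*2^s⇒r≤s r s le = s≤s⁻¹ (≮⇒≥ λ s<r → <⇒≱ (^-monoʳ-< 2 (s≤s (s≤s z≤n)) s<r) le)

m^[1+r]≤2*m^s⇒1+r≤s : ∀ m r s → 2 < m → m ^ suc r ≤ 2 * m ^ s → suc r ≤ s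
m^[1+r]≤2*m^s⇒1+r≤s m@(suc _) r s 2<m le = s≤s⁻¹ (^-cancelʳ-< m (≤-<-trans le (*-monoˡ-< (m ^ s) 2<m)))
  where instance _ = m^n≢0 m s

module _ (p : ℕ) (ps : List ℕ) (chain : Linked _∣_ (map suc (p ∷ ps))) where

  private
    r = length (p ∷ ps)
    |S|-lowerBound = LowerBound.|S|-lowerBound p ps (Linked⇒All ∣-trans ∣-refl chain)

  rank≤|S| : p ≡ 1 → ∀ (C : HamCycle (map suc (p ∷ ps))) → r ≤ |S| C
  rank≤|S| refl C = 2^[1+r]≤2*2^s⇒r≤s r (|S| C) (|S|-lowerBound (s≤s z≤n) C)

  1+rank≤|S| : 2 < suc p → ∀ (C : HamCycle (map suc (p ∷ ps))) → suc r ≤ |S| C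
  1+rank≤|S| 2<m C = m^[1+r]≤2*m^s⇒1+r≤s (suc p) r (|S| C) 2<m (|S|-lowerBound (s≤s⁻¹ (<⇒≤ 2<m)) C)

  sMin≡rank : p ≡ 1 → IsSMin (map suc (p ∷ ps)) r
  sMin≡rank refl with ℤ₂-|S|≤rank ps
  ... | C , |S|≤r = IsSMin-intro C |S|≤r (rank≤|S| refl)

  sMin≡1+rank : 2 < suc p → 2 ∣ product (map suc (p ∷ ps)) → IsSMin (map suc (p ∷ ps)) (suc r)
  sMin≡1+rank 2<m 2∣n with evenOrder-|S|≤1+rank (p ∷ ps) 2∣n
  ... | C , |S|≤1+r = IsSMin-intro C |S|≤1+r (1+rank≤|S| 2<m)

  sMin-odd : 1 < suc p → ¬ 2 ∣ product (map suc (p ∷ ps)) →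
    ∃ λ k → IsSMin (map suc (p ∷ ps)) k × suc r ≤ k × k ≤ 2 + r
  sMin-odd 1<m ¬2∣n with oddOrder-|S|≤2+rank p ps ¬2∣n
  ... | C₀ , |S₀|≤2+r with minimalCycle C₀
  ...   | C , minimal = |S| C , ((C , refl) , minimal) , 1+rank≤|S| 2<m C , ≤-trans (minimal C₀) |S₀|≤2+r
    where
    2<m : 2 < suc p
    2<m = ≤∧≢⇒< 1<m λ { refl → ¬2∣n (divides (product (map suc ps)) (*-comm 2 (product (map suc ps)))) }

All-1<⇒≡map-suc : ∀ {ms} → All (1 <_) ms → ∃ λ ps → ms ≡ map suc ps
All-1<⇒≡map-suc []                    = [] , refl
All-1<⇒≡map-suc (s≤s {n = p} _ ∷ 1<ms) with All-1<⇒≡map-suc 1<ms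
... | ps , refl = p ∷ ps , refl

2+r≤1+2*r : ∀ {r} → 1 ≤ r → 2 + r ≤ 1 + 2 * r
2+r≤1+2*r {r} 1≤r = s≤s (subst (suc r ≤_) (trans (sym (k*2≡k+k r)) (*-comm r 2)) (+-monoˡ-≤ r 1≤r))

theorem4 : (m : ℕ) (ms : List ℕ) → All (1 <_) (m ∷ ms) → Linked _∣_ (m ∷ ms) →
    ((2 ∣ product (m ∷ ms)) →
        ((m ≡ 2 → IsSMin (m ∷ ms) (length (m ∷ ms)))
        × (2 < m → IsSMin (m ∷ ms) (suc (length (m ∷ ms))))))
    × (¬ (2 ∣ product (m ∷ ms)) →
        ∃ λ k → IsSMin (m ∷ ms) k
          × (suc (length (m ∷ ms)) ≤ k)
          × (k ≤ suc (2 * length (m ∷ ms))))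
theorem4 m ms 1<ms chain with All-1<⇒≡map-suc 1<ms
... | p ∷ ps , refl rewrite length-map suc ps =
  (λ 2∣n → sMin≡rank p ps chain ∘ suc-injective , λ 2<m → sMin≡1+rank p ps chain 2<m 2∣n) ,
  λ ¬2∣n → let k , sMin , 1+r≤k , k≤2+r = sMin-odd p ps chain (All.head 1<ms) ¬2∣n
           in k , sMin , 1+r≤k , ≤-trans k≤2+r (2+r≤1+2*r (s≤s z≤n))
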